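{- $sh(\mathcal{C}, \mathtt{XYX})$ has $0$, $2$ or $4$ elements.
   Context: Let $\mathcal{B}=\{\mathtt{A},\mathtt{C},\mathtt{G},\mathtt{T}\}$ be the genetic alphabet, and let $c\colon\mathcal{B}\to\mathcal{B}$ be the complementarity map $c(\mathtt{A})=\mathtt{T}$, $c(\mathtt{T})=\mathtt{A}$, $c(\mathtt{C})=\mathtt{G}$, $c(\mathtt{G})=\mathtt{C}$. For a codon $w=N_1N_2N_3\in\mathcal{B}^3$ its reverse complement is $\overleftarrow{c}(w)=c(N_3)c(N_2)c(N_1)$, and $\alpha(N_1N_2N_3)=N_3N_1N_2$ is the cyclic shift. A set of 3-letter words is a circular code if any concatenation of its words written on a circle can be decomposed into a concatenation of its words in a unique way. Throughout, "circular code" means a maximal $C^3$ circular code: a circular code $\mathcal{C}$ with $|\mathcal{C}|=20$, $\overleftarrow{c}(\mathcal{C})=\mathcal{C}$, and $\alpha(\mathcal{C})$ (hence also $\alpha^2(\mathcal{C})$) circular. A codon has shape $\mathtt{XXY}$, $\mathtt{XYY}$, $\mathtt{XYX}$ or $\mathtt{XYZ}$ if it is obtained from this pattern by substituting bases for $\mathtt{X},\mathtt{Y},\mathtt{Z}$ (distinct letters standing for distinct bases). For a circular code $\mathcal{C}$ and a shape $S$, $sh(\mathcal{C},S)$ denotes the set of codons of $\mathcal{C}$ of shape $S$. -}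

module Defs where

open import Data.Bool using (Bool; true; false; _∧_; not; T?)
open import Data.List using (List; []; _∷_; _++_; concat; map; filter; length; concatMap)
open import Data.List.Relation.Unary.All using (All)
open import Data.Nat using (ℕ)
open import Data.Product using (Σ; _×_; _,_)
open import Relation.Binary.PropositionalEquality using (_≡_; _≢_)
open import Relation.Nullary using (¬_)

data Base : Set where
  A C G T : Base

allBases : List Base
allBases = A ∷ C ∷ G ∷ T ∷ []

comp : Base → Base
comp A = T
comp T = A
comp C = G
comp G = C

_==_ : Base → Base → Bool
A == A = true
C == C = true
G == G = true
T == T = true
_ == _ = false

record Codon : Set where
  constructor codon
  field
    n₁ n₂ n₃ : Base
open Codon public

allCodons : List Codon
allCodons = concatMap (λ a → concatMap (λ b → map (λ c → codon a b c) allBases) allBases) allBases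

rc : Codon → Codon
rc (codon a b c) = codon (comp c) (comp b) (comp a)

α : Codon → Codon
α (codon a b c) = codon c a b

word : Codon → List Base
word (codon a b c) = a ∷ b ∷ c ∷ []

concatW : List Codon → List Base
concatW xs = concat (map word xs)

-- Circular code (standard definition, Berstel-Perrin): X is circular iff
-- for all n, m ≥ 1, x1..xn, y1..ym ∈ X, p ∈ B*, s ∈ B+,
--   s x2 ... xn p = y1 ... ym  and  x1 = p s
-- imply n = m, p = ε and x_i = y_i for all i.
Circular : (Codon → Set) → Set
Circular X =
  (x₁ : Codon) (xs ys : List Codon) (p s : List Base) →
  X x₁ → All X xs → All X ys → s ≢ [] →
  word x₁ ≡ p ++ s →
  s ++ concatW xs ++ p ≡ concatW ys →
  (p ≡ []) × (x₁ ∷ xs ≡ ys)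

Code : Set
Code = Codon → Bool

_∈C_ : Codon → Code → Set
w ∈C 𝒞 = 𝒞 w ≡ true

αImage : (Codon → Set) → Codon → Set
αImage X w = Σ Codon (λ v → X v × α v ≡ w)

size : Code → ℕ
size 𝒞 = length (filter (λ w → T? (𝒞 w)) allCodons)

IsMaxC3 : Code → Set
IsMaxC3 𝒞 =
  size 𝒞 ≡ 20 ×
  (∀ w → 𝒞 (rc w) ≡ 𝒞 w) ×
  Circular (_∈C 𝒞) ×
  Circular (αImage (_∈C 𝒞)) ×
  Circular (αImage (αImage (_∈C 𝒞)))

isXYX : Codon → Bool
isXYX (codon a b c) = (a == c) ∧ not (a == b)

-- sh(𝒞, XYX) as a list of codons (without repetition, since allCodons has none)
shXYX : Code → List Codon
shXYX 𝒞 = filter (λ w → T? (𝒞 w ∧ isXYX w)) allCodons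

-- An XYX codon aba and its swap bab cannot both lie in a circular code, since the
-- circular word (aba)(bab) also factors as (bab)(aba). The twelve XYX codons come in
-- six reverse-complement pairs; for ATA and CGC the reverse complement is the swap,
-- so they are excluded, and self-complementarity doubles the count of the remaining
-- representatives ACA, AGA, CAC, CTC. Of these, ACA excludes its swap CAC and AGA
-- excludes CTC (whose complement GAG is the swap of AGA), so at most two survive.
module Submission where

open import Defs
open import Data.Bool using (Bool; true; false; _∧_)
open import Data.Bool.Properties using (∧-zeroʳ; ∧-identityʳ)
open import Data.Empty using (⊥; ⊥-elim)
open import Data.List using (List; []; _∷_; _++_; map; reverse; length; filterᵇ)
open import Data.List.Properties using (map-++)
open import Data.List.Relation.Binary.Permutation.Propositional.Properties using (↭-reverse; map⁺)
open import Data.List.Relation.Unary.All using ([]; _∷_)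
open import Data.Nat using (ℕ; suc; _+_; _*_; _≤_; z≤n; s≤s)
open import Data.Nat.ListAction using (sum)
open import Data.Nat.ListAction.Properties using (sum-++; sum-↭)
open import Data.Nat.Properties using (+-identityʳ)
open import Data.Nat.Tactic.RingSolver using (solve-∀)
open import Data.Product using (_,_)
open import Data.Sum using (_⊎_; inj₁; inj₂)
open import Function using (_∘_)
open import Relation.Binary.PropositionalEquality using (_≡_; refl; sym; trans; cong; cong₂; subst; module ≡-Reasoning)

private
  variable
    X : Set

toℕ : Bool → ℕ
toℕ false = 0
toℕ true  = 1

count : (X → Bool) → List X → ℕ
count p xs = sum (map (toℕ ∘ p) xs)

length-filterᵇ : (p : X → Bool) (xs : List X) → length (filterᵇ p xs) ≡ count p xs
length-filterᵇ p [] = refl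
length-filterᵇ p (x ∷ xs) with p x
... | true  = cong suc (length-filterᵇ p xs)
... | false = length-filterᵇ p xs

count-∧ : (p q : X → Bool) (xs : List X) →
  count (λ x → p x ∧ q x) xs ≡ count p (filterᵇ q xs)
count-∧ p q [] = refl
count-∧ p q (x ∷ xs) with q x
... | false rewrite ∧-zeroʳ (p x) = count-∧ p q xs
... | true  rewrite ∧-identityʳ (p x) = cong (toℕ (p x) +_) (count-∧ p q xs)

count-++ : (p : X → Bool) (xs ys : List X) → count p (xs ++ ys) ≡ count p xs + count p ys
count-++ p xs ys = trans (cong sum (map-++ (toℕ ∘ p) xs ys)) (sum-++ (map (toℕ ∘ p) xs) _)

count-reverse : (p : X → Bool) (xs : List X) → count p (reverse xs) ≡ count p xs
count-reverse p xs = sum-↭ (map⁺ (toℕ ∘ p) (↭-reverse xs))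

count-map : (p : X → Bool) (f : X → X) → (∀ x → p (f x) ≡ p x) →
  (xs : List X) → count p (map f xs) ≡ count p xs
count-map p f p∘f≗p [] = refl
count-map p f p∘f≗p (x ∷ xs) = cong₂ _+_ (cong toℕ (p∘f≗p x)) (count-map p f p∘f≗p xs)

count-mirror : (p : X → Bool) (f : X → X) → (∀ x → p (f x) ≡ p x) →
  (xs : List X) → count p (xs ++ reverse (map f xs)) ≡ 2 * count p xs
count-mirror p f p∘f≗p xs = begin
  count p (xs ++ reverse (map f xs))         ≡⟨ count-++ p xs _ ⟩
  count p xs + count p (reverse (map f xs))  ≡⟨ cong (count p xs +_) (count-reverse p (map f xs)) ⟩
  count p xs + count p (map f xs)            ≡⟨ cong (count p xs +_) (count-map p f p∘f≗p xs) ⟩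
  count p xs + count p xs                    ≡⟨ cong (count p xs +_) (+-identityʳ _) ⟨
  2 * count p xs                             ∎
  where open ≡-Reasoning

-- p = a and s = ba shift the factorisation (aba)(bab) of the circular word by one letter.
circular-¬aba-bab : {P : Codon → Set} → Circular P →
  (a b : Base) → P (codon a b a) → P (codon b a b) → ⊥
circular-¬aba-bab circular a b aba bab
  with circular (codon a b a) (codon b a b ∷ []) (codon b a b ∷ codon a b a ∷ [])
                (a ∷ []) (b ∷ a ∷ []) aba (bab ∷ []) (bab ∷ aba ∷ []) (λ ()) refl refl
... | () , _

SelfComplementary : Code → Set
SelfComplementary 𝒞 = ∀ w → 𝒞 (rc w) ≡ 𝒞 w

rc≡swap⇒∉ : (𝒞 : Code) → SelfComplementary 𝒞 → Circular (_∈C 𝒞) →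
  (a b : Base) → rc (codon a b a) ≡ codon b a b → 𝒞 (codon a b a) ≡ false
rc≡swap⇒∉ 𝒞 sc circular a b rc-swaps with 𝒞 (codon a b a) in aba∈
... | false = refl
... | true  = ⊥-elim (circular-¬aba-bab circular a b aba∈ bab∈)
  where
  open ≡-Reasoning
  bab∈ : codon b a b ∈C 𝒞
  bab∈ = begin
    𝒞 (codon b a b)      ≡⟨ cong 𝒞 rc-swaps ⟨
    𝒞 (rc (codon a b a)) ≡⟨ sc (codon a b a) ⟩
    𝒞 (codon a b a)      ≡⟨ aba∈ ⟩
    true                 ∎

-- In the order of allCodons, the XYX codons are these six followed by their
-- reverse complements in reverse order.
xyxRepresentatives : List Codon
xyxRepresentatives =
  codon A C A ∷ codon A G A ∷ codon A T A ∷ codon C A C ∷ codon C G C ∷ codon C T C ∷ []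

length-shXYX : (𝒞 : Code) → SelfComplementary 𝒞 →
  length (shXYX 𝒞) ≡ 2 * count 𝒞 xyxRepresentatives
length-shXYX 𝒞 sc = begin
  length (shXYX 𝒞)                        ≡⟨ length-filterᵇ (λ w → 𝒞 w ∧ isXYX w) allCodons ⟩
  count (λ w → 𝒞 w ∧ isXYX w) allCodons   ≡⟨ count-∧ 𝒞 isXYX allCodons ⟩
  count 𝒞 (filterᵇ isXYX allCodons)       ≡⟨⟩
  count 𝒞 (reps ++ reverse (map rc reps)) ≡⟨ count-mirror 𝒞 rc sc reps ⟩
  2 * count 𝒞 reps                        ∎
  where
  open ≡-Reasoning
  reps = xyxRepresentatives

count-xyxRepresentatives : (𝒞 : Code) → 𝒞 (codon A T A) ≡ false → 𝒞 (codon C G C) ≡ false →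
  count 𝒞 xyxRepresentatives ≡ (toℕ (𝒞 (codon A C A)) + toℕ (𝒞 (codon C A C)))
                             + (toℕ (𝒞 (codon A G A)) + toℕ (𝒞 (codon C T C)))
count-xyxRepresentatives 𝒞 ATA∉ CGC∉ rewrite ATA∉ | CGC∉ =
  rearrange (toℕ (𝒞 (codon A C A))) (toℕ (𝒞 (codon A G A)))
            (toℕ (𝒞 (codon C A C))) (toℕ (𝒞 (codon C T C)))
  where
  rearrange : ∀ a g c t → a + (g + (c + (t + 0))) ≡ (a + c) + (g + t)
  rearrange = solve-∀

exclusive⇒toℕ+toℕ≤1 : (x y : Bool) → (x ≡ true → y ≡ true → ⊥) → toℕ x + toℕ y ≤ 1
exclusive⇒toℕ+toℕ≤1 true  true  ¬x∧y = ⊥-elim (¬x∧y refl refl)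
exclusive⇒toℕ+toℕ≤1 true  false _    = s≤s z≤n
exclusive⇒toℕ+toℕ≤1 false true  _    = s≤s z≤n
exclusive⇒toℕ+toℕ≤1 false false _    = z≤n

double-sum-≤1 : {i j : ℕ} → i ≤ 1 → j ≤ 1 →
  (2 * (i + j) ≡ 0) ⊎ (2 * (i + j) ≡ 2) ⊎ (2 * (i + j) ≡ 4)
double-sum-≤1 z≤n       z≤n       = inj₁ refl
double-sum-≤1 z≤n       (s≤s z≤n) = inj₂ (inj₁ refl)
double-sum-≤1 (s≤s z≤n) z≤n       = inj₂ (inj₁ refl)
double-sum-≤1 (s≤s z≤n) (s≤s z≤n) = inj₂ (inj₂ refl)

mainTheorem1 : (𝒞 : Code) → IsMaxC3 𝒞 →
    (length (shXYX 𝒞) ≡ 0) ⊎ (length (shXYX 𝒞) ≡ 2) ⊎ (length (shXYX 𝒞) ≡ 4)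
mainTheorem1 𝒞 (_ , sc , circular , _) =
  subst (λ n → (n ≡ 0) ⊎ (n ≡ 2) ⊎ (n ≡ 4)) (sym length≡)
    (double-sum-≤1 (exclusive⇒toℕ+toℕ≤1 _ _ ¬ACA∧CAC) (exclusive⇒toℕ+toℕ≤1 _ _ ¬AGA∧CTC))
  where
  ¬ACA∧CAC : codon A C A ∈C 𝒞 → codon C A C ∈C 𝒞 → ⊥
  ¬ACA∧CAC = circular-¬aba-bab circular A C
  ¬AGA∧CTC : codon A G A ∈C 𝒞 → codon C T C ∈C 𝒞 → ⊥
  ¬AGA∧CTC AGA∈ CTC∈ = circular-¬aba-bab circular A G AGA∈ (trans (sc (codon C T C)) CTC∈)
  length≡ : length (shXYX 𝒞) ≡ 2 * ( (toℕ (𝒞 (codon A C A)) + toℕ (𝒞 (codon C A C)))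
                                   + (toℕ (𝒞 (codon A G A)) + toℕ (𝒞 (codon C T C))))
  length≡ = trans (length-shXYX 𝒞 sc) (cong (2 *_) (count-xyxRepresentatives 𝒞
    (rc≡swap⇒∉ 𝒞 sc circular A T refl) (rc≡swap⇒∉ 𝒞 sc circular C G refl)))
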